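{- Let $k\ge 3$, let $n\ge 1$, and let $j$ be the integer with $0\le j\le k-1$ and $n\equiv j \pmod k$. If $j\neq 0$, then the two-letter word $(n-j)\,n$ is a suffix of $\varphi_k^n(0)$. If $j=0$, then the two-letter word $(n-k+1)\,n$ is a suffix of $\varphi_k^n(0)$.
   Context: The alphabet is $\mathbb{N}=\{0,1,2,\dots\}$. For an integer $k\ge 3$, $\varphi_k$ is the morphism of $\mathbb{N}^*$ defined on letters, for $i\ge 0$ and $0\le j\le k-1$, by $\varphi_k(ki+j)=(ki)(ki+j+1)$ (two letters) if $0\le j\le k-2$, and $\varphi_k(ki+k-1)=(ki+k)$ (one letter). -}

module Defs where

open import Data.Nat using (ℕ; zero; suc; _+_; _*_; _∸_; _≤_; _<_; NonZero; _≟_)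
open import Relation.Nullary using (yes; no)
open import Data.Nat.DivMod using (_/_; _%_)
open import Data.List using (List; []; _∷_; _++_; concatMap)
open import Data.Product using (∃)
open import Relation.Binary.PropositionalEquality using (_≡_)

-- The morphism φ_k on a single letter x = k*i + j (i = x / k, j = x % k):
--   φ_k(ki+j)     = (ki)(ki+j+1)  if j ≤ k-2
--   φ_k(ki+k-1)   = (ki+k)
φLetter : (k : ℕ) → .{{_ : NonZero k}} → ℕ → List ℕ
φLetter k x with suc (x % k) ≟ k
... | yes _ = (x + 1) ∷ []
... | no  _ = (k * (x / k)) ∷ (x + 1) ∷ []

φ : (k : ℕ) → .{{_ : NonZero k}} → List ℕ → List ℕ
φ k = concatMap (φLetter k)

φ^ : (k : ℕ) → .{{_ : NonZero k}} → ℕ → List ℕ → List ℕ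
φ^ k zero    w = w
φ^ k (suc n) w = φ k (φ^ k n w)

IsSuffix : List ℕ → List ℕ → Set
IsSuffix u w = ∃ λ v → v ++ u ≡ w

-- The last letter of φ_k(x) is always x + 1, so φ_k^n(0) ends with n and its
-- last two letters are the images of the last two letters y n of φ_k^(n-1)(0).
-- If n ≢ k - 1 (mod k), then φ_k(n) = (n - n mod k)(n + 1) already supplies both
-- letters.  Otherwise φ_k(n) = n + 1 is a single letter, the preceding letter is
-- y + 1, and y = n - (k - 1) by induction since n mod k = k - 1 ≠ 0.
module Submission where

open import Defs
open import Data.Nat using (ℕ; zero; suc; _+_; _*_; _/_; _∸_; _≤_; NonZero; _≟_)
open import Data.Nat.Properties
  using (+-comm; *-comm; *-zeroʳ; m+n∸m≡n; +-∸-assoc; ≤∧≢⇒<; <⇒≢; ∸-monoˡ-≤; ≤-trans; n≤1+n; 0≢1+n; 1+n≢0)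
open import Data.Nat.DivMod
  using (_%_; m≡m%n+[m/n]*n; [m+kn]%n≡m%n; m<n⇒m%n≡m; m%n<n; m%n≤m; n%n≡0; 0/n≡0)
open import Data.List using (List; []; _∷_; _++_; [_])
open import Data.List.Properties using (concatMap-++; ++-assoc; ++-identityʳ)
open import Data.Product using (_×_; _,_)
open import Data.Empty using (⊥-elim)
open import Relation.Nullary using (Dec; yes; no)
open import Relation.Binary.PropositionalEquality
  using (_≡_; _≢_; refl; sym; trans; cong; subst; subst₂; module ≡-Reasoning)

open ≡-Reasoning

IsSuffix-trans : ∀ {u v w} → IsSuffix u v → IsSuffix v w → IsSuffix u w
IsSuffix-trans (a , a++u≡v) (b , b++v≡w) =
  b ++ a , trans (++-assoc b a _) (trans (cong (b ++_) a++u≡v) b++v≡w)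

IsSuffix-++ˡ : ∀ a {u w} → IsSuffix u w → IsSuffix u (a ++ w)
IsSuffix-++ˡ a (b , b++u≡w) = a ++ b , trans (++-assoc a b _) (cong (a ++_) b++u≡w)

IsSuffix-++ʳ : ∀ {u w} b → IsSuffix u w → IsSuffix (u ++ b) (w ++ b)
IsSuffix-++ʳ b (a , a++u≡w) = a , trans (sym (++-assoc a _ b)) (cong (_++ b) a++u≡w)

module _ (k : ℕ) .{{_ : NonZero k}} where

  suc-% : ∀ m → suc m % k ≡ suc (m % k) % k
  suc-% m = begin
    suc m % k                      ≡⟨ cong (λ x → suc x % k) (m≡m%n+[m/n]*n m k) ⟩
    (suc (m % k) + m / k * k) % k  ≡⟨ [m+kn]%n≡m%n (suc (m % k)) (m / k) k ⟩
    suc (m % k) % k                ∎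

  suc-%-not-last : ∀ m → suc (m % k) ≢ k → suc m % k ≡ suc (m % k)
  suc-%-not-last m ≢k = trans (suc-% m) (m<n⇒m%n≡m (≤∧≢⇒< (m%n<n m k) ≢k))

  suc-%-last : ∀ m → suc (m % k) ≡ k → suc m % k ≡ 0
  suc-%-last m ≡k = trans (suc-% m) (trans (cong (_% k) ≡k) (n%n≡0 k))

  k*[m/k]≡m∸m%k : ∀ m → k * (m / k) ≡ m ∸ m % k
  k*[m/k]≡m∸m%k m = begin
    k * (m / k)                  ≡⟨ *-comm k (m / k) ⟩
    m / k * k                    ≡⟨ m+n∸m≡n (m % k) (m / k * k) ⟨
    (m % k + m / k * k) ∸ m % k  ≡⟨ cong (_∸ m % k) (m≡m%n+[m/n]*n m k) ⟨
    m ∸ m % k                    ∎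

  φLetter-not-last : ∀ x → suc (x % k) ≢ k → φLetter k x ≡ k * (x / k) ∷ suc x ∷ []
  φLetter-not-last x ≢k with suc (x % k) ≟ k
  ... | yes ≡k = ⊥-elim (≢k ≡k)
  ... | no  _  = cong (λ y → k * (x / k) ∷ y ∷ []) (+-comm x 1)

  φLetter-last : ∀ x → suc (x % k) ≡ k → φLetter k x ≡ [ suc x ]
  φLetter-last x ≡k with suc (x % k) ≟ k
  ... | yes _   = cong [_] (+-comm x 1)
  ... | no  ≢k  = ⊥-elim (≢k ≡k)

  φLetter-endsWith-suc : ∀ x → IsSuffix [ suc x ] (φLetter k x)
  φLetter-endsWith-suc x with suc (x % k) ≟ k
  ... | yes _ = [] , cong [_] (+-comm 1 x)
  ... | no  _ = [ k * (x / k) ] , cong (λ y → k * (x / k) ∷ y ∷ []) (+-comm 1 x)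

  φ-++ : ∀ v w → φ k (v ++ w) ≡ φ k v ++ φ k w
  φ-++ = concatMap-++ (φLetter k)

  φ-pair : ∀ x y → φ k (x ∷ y ∷ []) ≡ φLetter k x ++ φLetter k y
  φ-pair x y = cong (φLetter k x ++_) (++-identityʳ (φLetter k y))

  IsSuffix-φ : ∀ {u w} → IsSuffix u w → IsSuffix (φ k u) (φ k w)
  IsSuffix-φ (v , v++u≡w) = φ k v , trans (sym (φ-++ v _)) (cong (φ k) v++u≡w)

  penultimate : ℕ → ℕ
  penultimate n with n % k ≟ 0
  ... | yes _ = n ∸ (k ∸ 1)
  ... | no  _ = n ∸ n % k

  penultimate-≡0 : ∀ n → n % k ≡ 0 → penultimate n ≡ n ∸ (k ∸ 1)
  penultimate-≡0 n ≡0 with n % k ≟ 0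
  ... | yes _  = refl
  ... | no ≢0  = ⊥-elim (≢0 ≡0)

  penultimate-≢0 : ∀ n → n % k ≢ 0 → penultimate n ≡ n ∸ n % k
  penultimate-≢0 n ≢0 with n % k ≟ 0
  ... | yes ≡0 = ⊥-elim (≢0 ≡0)
  ... | no  _  = refl

  EndsWith : ℕ → List ℕ → Set
  EndsWith m = IsSuffix (penultimate m ∷ m ∷ [])

  φLetter-pair-endsWith-not-last : ∀ m → suc (m % k) ≢ k →
    EndsWith (suc m) (φLetter k (penultimate m) ++ φLetter k m)
  φLetter-pair-endsWith-not-last m ≢k =
    IsSuffix-++ˡ (φLetter k (penultimate m))
      ([] , trans (cong (_∷ suc m ∷ []) penultimate-suc) (sym (φLetter-not-last m ≢k)))
    where
    suc-%≡ : suc m % k ≡ suc (m % k)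
    suc-%≡ = suc-%-not-last m ≢k
    penultimate-suc : penultimate (suc m) ≡ k * (m / k)
    penultimate-suc = begin
      penultimate (suc m)  ≡⟨ penultimate-≢0 (suc m) (λ ≡0 → 0≢1+n (trans (sym ≡0) suc-%≡)) ⟩
      suc m ∸ suc m % k      ≡⟨ cong (suc m ∸_) suc-%≡ ⟩
      m ∸ m % k              ≡⟨ k*[m/k]≡m∸m%k m ⟨
      k * (m / k)            ∎

module _ (k : ℕ) .{{_ : NonZero k}} (2≤k : 2 ≤ k) where

  φLetter-pair-endsWith-last : ∀ m → suc (m % k) ≡ k →
    EndsWith k (suc m) (φLetter k (penultimate k m) ++ φLetter k m)
  φLetter-pair-endsWith-last m ≡k =
    subst₂ (λ y w → IsSuffix (y ∷ suc m ∷ []) w)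
      penultimate-suc (cong (φLetter k (penultimate k m) ++_) (sym (φLetter-last k m ≡k)))
      (IsSuffix-++ʳ [ suc m ] (φLetter-endsWith-suc k (penultimate k m)))
    where
    m%k≡k∸1 : m % k ≡ k ∸ 1
    m%k≡k∸1 = cong (_∸ 1) ≡k
    m%k≢0 : m % k ≢ 0
    m%k≢0 ≡0 = <⇒≢ (∸-monoˡ-≤ 1 2≤k) (trans (sym ≡0) m%k≡k∸1)
    penultimate-suc : suc (penultimate k m) ≡ penultimate k (suc m)
    penultimate-suc = begin
      suc (penultimate k m)  ≡⟨ cong suc (penultimate-≢0 k m m%k≢0) ⟩
      suc (m ∸ m % k)        ≡⟨ +-∸-assoc 1 (m%n≤m m k) ⟨
      suc m ∸ m % k          ≡⟨ cong (suc m ∸_) m%k≡k∸1 ⟩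
      suc m ∸ (k ∸ 1)        ≡⟨ penultimate-≡0 k (suc m) (suc-%-last k m ≡k) ⟨
      penultimate k (suc m)  ∎

  φLetter-pair-endsWith : ∀ m → EndsWith k (suc m) (φLetter k (penultimate k m) ++ φLetter k m)
  φLetter-pair-endsWith m = byCase (suc (m % k) ≟ k)
    where
    byCase : Dec (suc (m % k) ≡ k) → EndsWith k (suc m) (φLetter k (penultimate k m) ++ φLetter k m)
    byCase (yes ≡k) = φLetter-pair-endsWith-last m ≡k
    byCase (no  ≢k) = φLetter-pair-endsWith-not-last k m ≢k

  EndsWith-φ : ∀ m {w} → EndsWith k m w → EndsWith k (suc m) (φ k w)
  EndsWith-φ m ends =
    IsSuffix-trans (φLetter-pair-endsWith m)
      (subst (λ u → IsSuffix u _) (φ-pair k (penultimate k m) m) (IsSuffix-φ k ends))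

  EndsWith-φ[0] : EndsWith k 1 (φ k [ 0 ])
  EndsWith-φ[0] = [] , (begin
    penultimate k 1 ∷ 1 ∷ []  ≡⟨ cong (_∷ 1 ∷ []) penultimate-1 ⟩
    0 ∷ 1 ∷ []                ≡⟨ cong (_∷ 1 ∷ []) k*[0/k]≡0 ⟨
    k * (0 / k) ∷ 1 ∷ []      ≡⟨ φLetter-not-last k 0 1+0%k≢k ⟨
    φLetter k 0               ≡⟨ ++-identityʳ (φLetter k 0) ⟨
    φ k [ 0 ]                 ∎)
    where
    1%k≡1 : 1 % k ≡ 1
    1%k≡1 = m<n⇒m%n≡m 2≤k
    penultimate-1 : penultimate k 1 ≡ 0
    penultimate-1 = trans (penultimate-≢0 k 1 (λ ≡0 → 1+n≢0 (trans (sym 1%k≡1) ≡0)))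
                          (cong (1 ∸_) 1%k≡1)
    k*[0/k]≡0 : k * (0 / k) ≡ 0
    k*[0/k]≡0 = trans (cong (k *_) (0/n≡0 k)) (*-zeroʳ k)
    1+0%k≢k : suc (0 % k) ≢ k
    1+0%k≢k ≡k = <⇒≢ 2≤k (trans (cong suc (sym (m<n⇒m%n≡m (≤-trans (n≤1+n 1) 2≤k)))) ≡k)

  EndsWith-φ^[0] : ∀ n → EndsWith k (suc n) (φ^ k (suc n) [ 0 ])
  EndsWith-φ^[0] zero    = EndsWith-φ[0]
  EndsWith-φ^[0] (suc n) = EndsWith-φ (suc n) (EndsWith-φ^[0] n)

theorem3p3 : (k n : ℕ) → .{{_ : NonZero k}} → 3 ≤ k → 1 ≤ n →
    ((n % k ≢ 0 → IsSuffix ((n ∸ n % k) ∷ n ∷ []) (φ^ k n (0 ∷ []))) ×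
    (n % k ≡ 0 → IsSuffix ((n ∸ (k ∸ 1)) ∷ n ∷ []) (φ^ k n (0 ∷ []))))
theorem3p3 k (suc n) 3≤k _ =
  (λ ≢0 → subst lastTwo (penultimate-≢0 k (suc n) ≢0) endsWith) ,
  (λ ≡0 → subst lastTwo (penultimate-≡0 k (suc n) ≡0) endsWith)
  where
  endsWith : EndsWith k (suc n) (φ^ k (suc n) [ 0 ])
  endsWith = EndsWith-φ^[0] k (≤-trans (n≤1+n 2) 3≤k) n
  lastTwo : ℕ → Set
  lastTwo y = IsSuffix (y ∷ suc n ∷ []) (φ^ k (suc n) [ 0 ])
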